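{- For every integer $k \ge 4$ the following hold. (i) There are infinitely many $(k-1)$-colorable $B+E_\ell$ graphs $G$ with $\ell = \binom{k}{2}$ and $\mathrm{Kc}(G,k) \ge 2$. (ii) There are infinitely many $B+E_\ell$ graphs $G$ with chromatic number exactly $k$, $\ell = \binom{k}{2}-1$, and $\mathrm{Kc}(G,k) \ge 2$.
   Context: All graphs are finite and simple. A $k$-coloring of a graph $G$ is a map $c: V(G) \to \{1,\dots,k\}$ with $c(u)\neq c(v)$ for every edge $uv$ (not all colors need be used); $G$ is $k$-colorable if it has one, and its chromatic number is the least such $k$. A Kempe change swaps two colors $i,j$ on one connected component of the subgraph induced by vertices colored $i$ or $j$. Two $k$-colorings are Kempe equivalent if one is obtained from the other by a finite sequence of Kempe changes (possibly with different color pairs from $\{1,\dots,k\}$); $\mathrm{Kc}(G,k)$ is the number of Kempe equivalence classes of $k$-colorings of $G$. A $B+E_\ell$ graph is a graph obtained from a bipartite graph $B$ with partite sets $S$ and $T$ by adding $\ell$ new edges, each joining two vertices lying in the same partite set. -}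

module Defs where

open import Data.Nat using (ℕ; zero; suc; _+_; _<_; _≤_; _∸_)
open import Data.Nat.Combinatorics using (_C_)
open import Data.Fin using (Fin; zero; suc; _≟_) renaming (_<_ to _<ᶠ_)
open import Data.Fin.Properties using () renaming (_<?_ to _<ᶠ?_)
open import Data.Bool using (Bool; true; false; if_then_else_; _∧_)
open import Data.Bool.Properties using () renaming (_≟_ to _≟ᵇ_)
open import Data.Product using (Σ; ∃; _×_; _,_)
open import Data.Sum using (_⊎_)
open import Relation.Nullary using (¬_; does)
open import Relation.Binary.PropositionalEquality using (_≡_)
open import Relation.Binary.Construct.Closure.ReflexiveTransitive using (Star)

record Graph (n : ℕ) : Set where
  field
    adj   : Fin n → Fin n → Bool
    sym   : ∀ u v → adj u v ≡ adj v u
    irrefl : ∀ v → adj v v ≡ false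
open Graph public

Proper : ∀ {n} → Graph n → (k : ℕ) → (Fin n → Fin k) → Set
Proper G k c = ∀ u v → adj G u v ≡ true → ¬ (c u ≡ c v)

Colorable : ∀ {n} → Graph n → ℕ → Set
Colorable {n} G k = Σ (Fin n → Fin k) (Proper G k)

ChromaticNumberIs : ∀ {n} → Graph n → ℕ → Set
ChromaticNumberIs G k = Colorable G k × (∀ j → j < k → ¬ Colorable G j)

-- Kempe chains: u is in the component of v in the subgraph induced by
-- the vertices colored a or b.
InAB : ∀ {k} → Fin k → Fin k → Fin k → Set
InAB a b x = x ≡ a ⊎ x ≡ b

data Reach {n k : ℕ} (G : Graph n) (c : Fin n → Fin k) (a b : Fin k) (v : Fin n)
     : Fin n → Set where
  here : InAB a b (c v) → Reach G c a b v v
  step : ∀ {u w} → Reach G c a b v u → adj G u w ≡ true → InAB a b (c w)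
       → Reach G c a b v w

swapCol : ∀ {k} → Fin k → Fin k → Fin k → Fin k
swapCol a b x = if does (x ≟ a) then b else (if does (x ≟ b) then a else x)

KempeChange : ∀ {n k} → Graph n → (Fin n → Fin k) → (Fin n → Fin k) → Set
KempeChange {n} {k} G c c' =
  Σ (Fin k) λ a → Σ (Fin k) λ b → Σ (Fin n) λ v →
    InAB a b (c v) ×
    (∀ u → (Reach G c a b v u → c' u ≡ swapCol a b (c u))
         × (¬ Reach G c a b v u → c' u ≡ c u))

KempeEquivalent : ∀ {n k} → Graph n → (Fin n → Fin k) → (Fin n → Fin k) → Set
KempeEquivalent G = Star (KempeChange G)

KcAtLeast2 : ∀ {n} → Graph n → ℕ → Set
KcAtLeast2 {n} G k =
  Σ (Fin n → Fin k) λ c₁ → Σ (Fin n → Fin k) λ c₂ →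
    Proper G k c₁ × Proper G k c₂ × ¬ KempeEquivalent G c₁ c₂

sumFin : ∀ {n} → (Fin n → ℕ) → ℕ
sumFin {zero} f = 0
sumFin {suc n} f = f zero + sumFin (λ i → f (suc i))

sameSideEdges : ∀ {n} → Graph n → (Fin n → Bool) → ℕ
sameSideEdges G side = sumFin λ u → sumFin λ v →
  if does (u <ᶠ? v) ∧ adj G u v ∧ does (side u ≟ᵇ side v) then 1 else 0

IsBPlusE : ∀ {n} → Graph n → ℕ → Set
IsBPlusE {n} G ℓ = Σ (Fin n → Bool) λ side → sameSideEdges G side ≡ ℓ

{-# OPTIONS --safe #-}
module Submission where

-- Call a k-colouring c₁ frozen if, for all colours a ≠ b,
-- the non-isolated vertices coloured a or b form a single (a,b)-Kempe chain. A Kempe change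
-- then acts on the non-isolated vertices as a transposition of colours or not at all, so any
-- colouring Kempe equivalent to c₁ is, off the isolated vertices, c₁ followed by a permutation
-- of the colours; a colouring that merges two colour classes of c₁ lies in another class.
--
-- (i) Vertices s(a,b) and t(c) for colours a, b, c, with s(a,b) ~ s(b,a) for a ≠ b and
-- s(a,b) ~ t(c) for a ≠ c; with the s-vertices on one side only the binom(k,2) edges
-- s(a,b)s(b,a) lie inside a part. Colouring s(a,b) by a and t(c) by c is frozen, and
-- s(a,b) ↦ [a < b], t(c) ↦ 2 is a 3-colouring giving t(0) and t(1) the same colour.
-- (ii) A k-clique x₀ … x_{k−1} and a triangle y₀ y₁ y₂, with x_a ~ y_g unless a ∈ {g, g+1 mod 3}.
-- Colouring x_a by a and y_g by g is frozen; rotating the colours of the triangle gives another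
-- colouring, in which y₀ and x₁ agree.
-- Adding any number of isolated vertices gives infinitely many graphs.

open import Defs
open import Data.Nat using (ℕ; zero; suc; _+_; _*_; _∸_; _<_; _≤_; s≤s; z≤n; ⌊_/2⌋)
open import Data.Nat.Properties
  using ( +-assoc; +-comm; +-suc; suc-injective; +-identityʳ; *-identityʳ; +-cancelʳ-≡
        ; m≤n+m; ≤-trans; n≡⌊n+n/2⌋)
open import Data.Nat.Combinatorics using (_C_; nC1≡n; nCk+nC[k+1]≡[n+1]C[k+1])
open import Data.Nat.Solver using (module +-*-Solver)
open import Data.Fin as Fin using (Fin; zero; suc; _↑ˡ_; _↑ʳ_; combine; remQuot; splitAt; inject₁)
open import Data.Fin.Properties as Finₚ
  using ( <-cmp; <-asym; <-irrefl; <⇒≢; ↑ˡ-injective; splitAt-↑ˡ; splitAt-↑ʳ; remQuot-combine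
        ; inject₁-injective; pigeonhole)
open import Data.Bool using (Bool; true; false; if_then_else_; _∧_; not)
open import Data.Bool.Properties using (∧-zeroʳ; ∧-identityʳ) renaming (_≟_ to _≟ᵇ_)
open import Data.Product using (Σ; _×_; _,_; proj₁; proj₂)
open import Data.Sum using (_⊎_; inj₁; inj₂; [_,_])
open import Data.Empty using (⊥-elim)
open import Relation.Nullary using (¬_; does; yes; no; Dec)
open import Relation.Nullary.Decidable using (dec-true; dec-false; decidable-stable)
open import Relation.Binary using (tri<; tri≈; tri>; DecidableEquality)
open import Relation.Binary.PropositionalEquality as ≡
  using (_≡_; _≢_; refl; cong; cong₂; trans)
open import Relation.Binary.Construct.Closure.ReflexiveTransitive using (ε; _◅_)

sumFin-cong : ∀ {n} {f g : Fin n → ℕ} → (∀ i → f i ≡ g i) → sumFin f ≡ sumFin g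
sumFin-cong {zero} f≗g = refl
sumFin-cong {suc n} f≗g = cong₂ _+_ (f≗g zero) (sumFin-cong (λ i → f≗g (suc i)))

sumFin-+ : ∀ {n} (f g : Fin n → ℕ) → sumFin (λ i → f i + g i) ≡ sumFin f + sumFin g
sumFin-+ {zero} f g = refl
sumFin-+ {suc n} f g =
  trans (cong (f zero + g zero +_) (sumFin-+ (λ i → f (suc i)) (λ i → g (suc i))))
        (interchange (f zero) (g zero) _ _)
  where
  open +-*-Solver
  interchange : ∀ a b c d → (a + b) + (c + d) ≡ (a + c) + (b + d)
  interchange = solve 4 (λ a b c d → (a :+ b) :+ (c :+ d) := (a :+ c) :+ (b :+ d)) refl

sumFin-const : ∀ {n} c → sumFin {n} (λ _ → c) ≡ n * c
sumFin-const {zero} c = refl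
sumFin-const {suc n} c = cong (c +_) (sumFin-const {n} c)

sumFin-zero : ∀ {n} {f : Fin n → ℕ} → (∀ i → f i ≡ 0) → sumFin f ≡ 0
sumFin-zero {zero} f≗0 = refl
sumFin-zero {suc n} f≗0 = cong₂ _+_ (f≗0 zero) (sumFin-zero (λ i → f≗0 (suc i)))

sumFin-swap : ∀ {m n} (f : Fin m → Fin n → ℕ) →
  sumFin (λ i → sumFin (λ j → f i j)) ≡ sumFin (λ j → sumFin (λ i → f i j))
sumFin-swap {zero} {n} f = ≡.sym (sumFin-zero {n} (λ _ → refl))
sumFin-swap {suc m} f =
  trans (cong (sumFin (f zero) +_) (sumFin-swap (λ i → f (suc i))))
        (≡.sym (sumFin-+ (f zero) _))

sumFin-↑ : ∀ m {n} (f : Fin (m + n) → ℕ) →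
  sumFin f ≡ sumFin (λ i → f (i ↑ˡ n)) + sumFin (λ j → f (m ↑ʳ j))
sumFin-↑ zero f = refl
sumFin-↑ (suc m) f =
  trans (cong (f zero +_) (sumFin-↑ m (λ i → f (suc i)))) (≡.sym (+-assoc (f zero) _ _))

sumFin-combine : ∀ m n (f : Fin (m * n) → ℕ) →
  sumFin f ≡ sumFin (λ i → sumFin (λ j → f (combine {m} {n} i j)))
sumFin-combine zero n f = refl
sumFin-combine (suc m) n f =
  trans (sumFin-↑ n f)
        (cong (sumFin (λ j → f (j ↑ˡ (m * n))) +_) (sumFin-combine m n (λ i → f (n ↑ʳ i))))

sumFin-if : ∀ {n} b (f : Fin n → ℕ) →
  sumFin (λ i → if b then f i else 0) ≡ (if b then sumFin f else 0)
sumFin-if true f = refl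
sumFin-if {n} false f = sumFin-zero {n} (λ _ → refl)

sumFin-point : ∀ {n} (w : Fin n) (f : Fin n → ℕ) →
  sumFin (λ i → if does (i Fin.≟ w) then f i else 0) ≡ f w
sumFin-point {suc n} zero f =
  trans (cong (f zero +_) (sumFin-zero {n} (λ _ → refl))) (+-identityʳ _)
sumFin-point {suc n} (suc w) f = sumFin-point w (λ i → f (suc i))

sumFin-≢ : ∀ {n} (w : Fin n) → sumFin (λ i → if does (w Fin.≟ i) then 0 else 1) + 1 ≡ n
sumFin-≢ {suc n} zero =
  trans (cong (_+ 1) (trans (sumFin-const {n} 1) (*-identityʳ n))) (+-comm n 1)
sumFin-≢ {suc (suc n)} (suc w) = cong suc (sumFin-≢ w)

sumFin²-≢ : ∀ n →
  sumFin (λ (a : Fin n) → sumFin (λ b → if does (a Fin.≟ b) then 0 else 1)) + n ≡ n * n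
sumFin²-≢ n = begin
  sumFin row + n
    ≡⟨ cong (sumFin row +_) (≡.sym (trans (sumFin-const {n} 1) (*-identityʳ n))) ⟩
  sumFin row + sumFin {n} (λ _ → 1)
    ≡⟨ ≡.sym (sumFin-+ row (λ _ → 1)) ⟩
  sumFin (λ a → row a + 1)
    ≡⟨ sumFin-cong {n} sumFin-≢ ⟩
  sumFin {n} (λ _ → n)
    ≡⟨ sumFin-const {n} n ⟩
  n * n ∎
  where
  open ≡.≡-Reasoning
  row : Fin n → ℕ
  row a = sumFin (λ b → if does (a Fin.≟ b) then 0 else 1)

Bool-ext : ∀ {x y : Bool} → (x ≡ true → y ≡ true) → (y ≡ true → x ≡ true) → x ≡ y
Bool-ext {true} {true} _ _ = refl
Bool-ext {false} {false} _ _ = refl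
Bool-ext {true} {false} x⇒y _ = ≡.sym (x⇒y refl)
Bool-ext {false} {true} _ y⇒x = y⇒x refl

≢⇒not-does : ∀ {n} {i j : Fin n} → i ≢ j → not (does (i Fin.≟ j)) ≡ true
≢⇒not-does {i = i} {j} i≢j rewrite dec-false (i Fin.≟ j) i≢j = refl

not-does⇒≢ : ∀ {n} {i j : Fin n} → not (does (i Fin.≟ j)) ≡ true → i ≢ j
not-does⇒≢ {i = i} {j} with i Fin.≟ j
... | yes _ = λ ()
... | no i≢j = λ _ → i≢j

does-≟-sym : ∀ {A : Set} (_≟_ : DecidableEquality A) x y → does (x ≟ y) ≡ does (y ≟ x)
does-≟-sym _≟_ x y with x ≟ y | y ≟ x
... | yes _ | yes _ = refl
... | no _ | no _ = refl
... | yes x≡y | no y≢x = ⊥-elim (y≢x (≡.sym x≡y))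
... | no x≢y | yes y≡x = ⊥-elim (x≢y (≡.sym y≡x))

module _ {n} (G : Graph n) (side : Fin n → Bool) where

  sameSideAdj : Fin n → Fin n → ℕ
  sameSideAdj u v = if adj G u v ∧ does (side u ≟ᵇ side v) then 1 else 0

  private
    sameSideAdj< : Fin n → Fin n → ℕ
    sameSideAdj< u v =
      if does (u Finₚ.<? v) ∧ adj G u v ∧ does (side u ≟ᵇ side v) then 1 else 0

    sameSideAdj<-+-flip : ∀ u v → sameSideAdj< u v + sameSideAdj< v u ≡ sameSideAdj u v
    sameSideAdj<-+-flip u v with <-cmp u v
    ... | tri< u<v _ _ rewrite dec-true (u Finₚ.<? v) u<v | dec-false (v Finₚ.<? u) (<-asym u<v) =
      +-identityʳ _
    ... | tri> _ _ v<u rewrite dec-true (v Finₚ.<? u) v<u | dec-false (u Finₚ.<? v) (<-asym v<u)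
                             | sym G u v | does-≟-sym _≟ᵇ_ (side u) (side v) = refl
    ... | tri≈ _ refl _ rewrite dec-false (u Finₚ.<? u) (<-irrefl refl) | irrefl G u = refl

  sameSideEdges-handshake :
    sameSideEdges G side + sameSideEdges G side ≡ sumFin (λ u → sumFin (sameSideAdj u))
  sameSideEdges-handshake = begin
    sameSideEdges G side + sameSideEdges G side
      ≡⟨ cong (sameSideEdges G side +_) (sumFin-swap sameSideAdj<) ⟩
    sumFin (λ u → sumFin (sameSideAdj< u)) + sumFin (λ u → sumFin (λ v → sameSideAdj< v u))
      ≡⟨ ≡.sym (sumFin-+ (λ u → sumFin (sameSideAdj< u)) (λ u → sumFin (λ v → sameSideAdj< v u))) ⟩
    sumFin (λ u → sumFin (sameSideAdj< u) + sumFin (λ v → sameSideAdj< v u))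
      ≡⟨ sumFin-cong (λ u → ≡.sym (sumFin-+ (sameSideAdj< u) (λ v → sameSideAdj< v u))) ⟩
    sumFin (λ u → sumFin (λ v → sameSideAdj< u v + sameSideAdj< v u))
      ≡⟨ sumFin-cong (λ u → sumFin-cong (sameSideAdj<-+-flip u)) ⟩
    sumFin (λ u → sumFin (sameSideAdj u)) ∎
    where open ≡.≡-Reasoning

m+m≡n+n⇒m≡n : ∀ m n → m + m ≡ n + n → m ≡ n
m+m≡n+n⇒m≡n m n e = trans (n≡⌊n+n/2⌋ m) (trans (cong ⌊_/2⌋ e) (≡.sym (n≡⌊n+n/2⌋ n)))

m+2≡n+n⇒m≡[n∸1]+[n∸1] : ∀ m n → m + 2 ≡ n + n → m ≡ (n ∸ 1) + (n ∸ 1)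
m+2≡n+n⇒m≡[n∸1]+[n∸1] m zero e with () ← trans (+-comm 2 m) e
m+2≡n+n⇒m≡[n∸1]+[n∸1] m (suc n) e =
  suc-injective (suc-injective (trans (+-comm 2 m) (trans e (cong suc (+-suc n n)))))

nC2+nC2+n≡n*n : ∀ n → n C 2 + n C 2 + n ≡ n * n
nC2+nC2+n≡n*n zero = refl
nC2+nC2+n≡n*n (suc n) = begin
  suc n C 2 + suc n C 2 + suc n       ≡⟨ cong (λ z → z + z + suc n) (≡.sym pascal) ⟩
  (n + n C 2) + (n + n C 2) + suc n   ≡⟨ regroup n (n C 2) ⟩
  (n C 2 + n C 2 + n) + suc (n + n)   ≡⟨ cong (_+ suc (n + n)) (nC2+nC2+n≡n*n n) ⟩
  n * n + suc (n + n)                 ≡⟨ square-suc n ⟩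
  suc n * suc n                       ∎
  where
  open ≡.≡-Reasoning
  open +-*-Solver
  pascal : n + n C 2 ≡ suc n C 2
  pascal = trans (cong (_+ n C 2) (≡.sym (nC1≡n n))) (nCk+nC[k+1]≡[n+1]C[k+1] n 1)
  regroup : ∀ n c → (n + c) + (n + c) + suc n ≡ (c + c + n) + suc (n + n)
  regroup = solve 2 (λ n c →
    (n :+ c) :+ (n :+ c) :+ (con 1 :+ n) := (c :+ c :+ n) :+ (con 1 :+ (n :+ n))) refl
  square-suc : ∀ n → n * n + suc (n + n) ≡ suc n * suc n
  square-suc = solve 1 (λ n → n :* n :+ (con 1 :+ (n :+ n)) := (con 1 :+ n) :* (con 1 :+ n)) refl

module _ {k} (a b : Fin k) where

  swapCol-a : swapCol a b a ≡ b
  swapCol-a with a Fin.≟ a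
  ... | yes _ = refl
  ... | no a≢a = ⊥-elim (a≢a refl)

  swapCol-b : swapCol a b b ≡ a
  swapCol-b with b Fin.≟ a
  ... | yes b≡a = b≡a
  ... | no _ with b Fin.≟ b
  ... | yes _ = refl
  ... | no b≢b = ⊥-elim (b≢b refl)

  swapCol-other : ∀ {x} → x ≢ a → x ≢ b → swapCol a b x ≡ x
  swapCol-other {x} x≢a x≢b with x Fin.≟ a
  ... | yes x≡a = ⊥-elim (x≢a x≡a)
  ... | no _ with x Fin.≟ b
  ... | yes x≡b = ⊥-elim (x≢b x≡b)
  ... | no _ = refl

swapCol-same : ∀ {k} (a x : Fin k) → swapCol a a x ≡ x
swapCol-same a x with x Fin.≟ a
... | yes x≡a = ≡.sym x≡a
... | no _ = refl

swapCol-involutive : ∀ {k} (a b x : Fin k) → swapCol a b (swapCol a b x) ≡ x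
swapCol-involutive a b x = by-cases (x Fin.≟ a) (x Fin.≟ b)
  where
  by-cases : Dec (x ≡ a) → Dec (x ≡ b) → swapCol a b (swapCol a b x) ≡ x
  by-cases (yes refl) _ = trans (cong (swapCol x b) (swapCol-a x b)) (swapCol-b x b)
  by-cases (no _) (yes refl) = trans (cong (swapCol a x) (swapCol-b a x)) (swapCol-a a x)
  by-cases (no x≢a) (no x≢b) =
    trans (cong (swapCol a b) (swapCol-other a b x≢a x≢b)) (swapCol-other a b x≢a x≢b)

module _ {n k} {G : Graph n} {c : Fin n → Fin k} {a b : Fin k} where

  reach-inAB : ∀ {v u} → Reach G c a b v u → InAB a b (c u)
  reach-inAB (here u∈ab) = u∈ab
  reach-inAB (step _ _ w∈ab) = w∈ab

  reach-trans : ∀ {v u w} → Reach G c a b v u → Reach G c a b u w → Reach G c a b v w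
  reach-trans v⇝u (here _) = v⇝u
  reach-trans v⇝u (step u⇝w′ e w∈ab) = step (reach-trans v⇝u u⇝w′) e w∈ab

  reach-sym : ∀ {v u} → Reach G c a b v u → Reach G c a b u v
  reach-sym (here v∈ab) = here v∈ab
  reach-sym (step {u} {w} v⇝u e w∈ab) =
    reach-trans (step (here w∈ab) (trans (sym G w u) e) (reach-inAB v⇝u)) (reach-sym v⇝u)

module Frozen {n k} (G : Graph n) (core : Fin n → Bool) (c₀ : Fin n → Fin k)
  (isolated : ∀ v w → core v ≡ false → adj G v w ≡ false)
  (hub : ∀ a b → a ≢ b → Σ (Fin n) λ h →
           ∀ u → core u ≡ true → InAB a b (c₀ u) → Reach G c₀ a b u h) where

  private
    true≢false : true ≢ false
    true≢false ()

  core-connected : ∀ {a b u v} → a ≢ b → core u ≡ true → core v ≡ true →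
    InAB a b (c₀ u) → InAB a b (c₀ v) → Reach G c₀ a b u v
  core-connected {a} {b} {u} {v} a≢b cu cv u∈ab v∈ab with hub a b a≢b
  ... | h , ⇝h = reach-trans (⇝h u cu u∈ab) (reach-sym (⇝h v cv v∈ab))

  reach-from-isolated : ∀ {c : Fin n → Fin k} {a b v u} →
    core v ≡ false → Reach G c a b v u → u ≡ v
  reach-from-isolated cv (here _) = refl
  reach-from-isolated {v = v} cv (step {w = w} v⇝u e _) with reach-from-isolated cv v⇝u
  ... | refl = ⊥-elim (true≢false (trans (≡.sym e) (isolated v w cv)))

  neighbour-in-core : ∀ {u w} → adj G u w ≡ true → core w ≡ true
  neighbour-in-core {u} {w} e with core w in cw
  ... | true = refl
  ... | false = ⊥-elim (true≢false (trans (≡.sym e) (trans (sym G u w) (isolated w u cw))))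

  reach-transport : ∀ {c c′ : Fin n → Fin k} {a b a′ b′ v u} →
    (∀ w → core w ≡ true → InAB a b (c w) → InAB a′ b′ (c′ w)) →
    core v ≡ true → Reach G c a b v u → Reach G c′ a′ b′ v u
  reach-transport recolour cv (here v∈ab) = here (recolour _ cv v∈ab)
  reach-transport recolour cv (step v⇝u e w∈ab) =
    step (reach-transport recolour cv v⇝u) e (recolour _ (neighbour-in-core e) w∈ab)

  record Relabelling (c : Fin n → Fin k) : Set where
    field
      σ σ⁻¹ : Fin k → Fin k
      σ∘σ⁻¹ : ∀ x → σ (σ⁻¹ x) ≡ x
      σ⁻¹∘σ : ∀ x → σ⁻¹ (σ x) ≡ x
      agrees : ∀ u → core u ≡ true → c u ≡ σ (c₀ u)

    c₀-from : ∀ {u} → core u ≡ true → c₀ u ≡ σ⁻¹ (c u)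
    c₀-from {u} cu = trans (≡.sym (σ⁻¹∘σ (c₀ u))) (cong σ⁻¹ (≡.sym (agrees u cu)))

    in-pair-σ⁻¹ : ∀ {a b w} → core w ≡ true → InAB a b (c w) → InAB (σ⁻¹ a) (σ⁻¹ b) (c₀ w)
    in-pair-σ⁻¹ cw (inj₁ refl) = inj₁ (c₀-from cw)
    in-pair-σ⁻¹ cw (inj₂ refl) = inj₂ (c₀-from cw)

    in-pair-σ : ∀ {a b w} → core w ≡ true → InAB (σ⁻¹ a) (σ⁻¹ b) (c₀ w) → InAB a b (c w)
    in-pair-σ {a} {b} {w} cw (inj₁ e) = inj₁ (trans (agrees w cw) (trans (cong σ e) (σ∘σ⁻¹ a)))
    in-pair-σ {a} {b} {w} cw (inj₂ e) = inj₂ (trans (agrees w cw) (trans (cong σ e) (σ∘σ⁻¹ b)))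

    σ⁻¹-injective : ∀ {a b} → a ≢ b → σ⁻¹ a ≢ σ⁻¹ b
    σ⁻¹-injective {a} {b} a≢b e = a≢b (trans (≡.sym (σ∘σ⁻¹ a)) (trans (cong σ e) (σ∘σ⁻¹ b)))

    kempe-component : ∀ {a b v u} → a ≢ b → core v ≡ true → core u ≡ true →
      InAB a b (c v) → InAB a b (c u) → Reach G c a b v u
    kempe-component a≢b cv cu v∈ab u∈ab = reach-transport (λ _ → in-pair-σ) cv
      (core-connected (σ⁻¹-injective a≢b) cv cu (in-pair-σ⁻¹ cv v∈ab) (in-pair-σ⁻¹ cu u∈ab))

  open Relabelling

  KempeSwitch : (c c′ : Fin n → Fin k) (a b : Fin k) (v : Fin n) → Set
  KempeSwitch c c′ a b v = ∀ u → (Reach G c a b v u → c′ u ≡ swapCol a b (c u))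
                               × (¬ Reach G c a b v u → c′ u ≡ c u)

  unchanged-on-core : ∀ {c c′ a b v} → core v ≡ false → KempeSwitch c c′ a b v →
    ∀ u → core u ≡ true → c′ u ≡ c u
  unchanged-on-core cv switch u cu = proj₂ (switch u) λ v⇝u →
    true≢false (trans (≡.sym cu) (trans (cong core (reach-from-isolated cv v⇝u)) cv))

  swapped-on-core : ∀ {c c′ a b v} → Relabelling c → core v ≡ true → InAB a b (c v) →
    KempeSwitch c c′ a b v → ∀ u → core u ≡ true → c′ u ≡ swapCol a b (c u)
  swapped-on-core {c} {c′} {a} {b} {v} R cv v∈ab switch u cu =
    -- Reach is not decidable, but the goal is an equation in Fin k,
    -- so the case split on Reach may be done under a double negation.
    decidable-stable (c′ u Fin.≟ swapCol a b (c u)) λ c′u≢swap →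
      let ¬v⇝u = λ v⇝u → c′u≢swap (proj₁ (switch u) v⇝u)
      in c′u≢swap (trans (proj₂ (switch u) ¬v⇝u) (unreached-fixed ¬v⇝u))
    where
    unreached-fixed : ¬ Reach G c a b v u → c u ≡ swapCol a b (c u)
    unreached-fixed ¬v⇝u = by-cases (a Fin.≟ b) (c u Fin.≟ a) (c u Fin.≟ b)
      where
      by-cases : Dec (a ≡ b) → Dec (c u ≡ a) → Dec (c u ≡ b) → c u ≡ swapCol a b (c u)
      by-cases (yes refl) _ _ = ≡.sym (swapCol-same a (c u))
      by-cases (no a≢b) (yes cu≡a) _ =
        ⊥-elim (¬v⇝u (kempe-component R a≢b cv cu v∈ab (inj₁ cu≡a)))
      by-cases (no a≢b) (no _) (yes cu≡b) =
        ⊥-elim (¬v⇝u (kempe-component R a≢b cv cu v∈ab (inj₂ cu≡b)))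
      by-cases (no _) (no cu≢a) (no cu≢b) = ≡.sym (swapCol-other a b cu≢a cu≢b)

  relabelling-step : ∀ {c c′} → Relabelling c → KempeChange G c c′ → Relabelling c′
  relabelling-step {c} {c′} R (a , b , v , v∈ab , switch) with core v in cv
  ... | false = record
    { σ = σ R ; σ⁻¹ = σ⁻¹ R ; σ∘σ⁻¹ = σ∘σ⁻¹ R ; σ⁻¹∘σ = σ⁻¹∘σ R
    ; agrees = λ u cu → trans (unchanged-on-core cv switch u cu) (agrees R u cu)
    }
  ... | true = record
    { σ = λ x → swapCol a b (σ R x)
    ; σ⁻¹ = λ x → σ⁻¹ R (swapCol a b x)
    ; σ∘σ⁻¹ = λ x → trans (cong (swapCol a b) (σ∘σ⁻¹ R _)) (swapCol-involutive a b x)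
    ; σ⁻¹∘σ = λ x → trans (cong (σ⁻¹ R) (swapCol-involutive a b _)) (σ⁻¹∘σ R x)
    ; agrees = λ u cu → trans (swapped-on-core R cv v∈ab switch u cu)
                              (cong (swapCol a b) (agrees R u cu))
    }

  relabelling-star : ∀ {c c′} → Relabelling c → KempeEquivalent G c c′ → Relabelling c′
  relabelling-star R ε = R
  relabelling-star R (change ◅ changes) = relabelling-star (relabelling-step R change) changes

  not-kempe-equivalent : ∀ {c u v} → core u ≡ true → core v ≡ true →
    c₀ u ≢ c₀ v → c u ≡ c v → ¬ KempeEquivalent G c₀ c
  not-kempe-equivalent {c} {u} {v} cu cv c₀u≢c₀v cu≡cv c₀∼c =
    c₀u≢c₀v (trans (c₀-from R cu) (trans (cong (σ⁻¹ R) cu≡cv) (≡.sym (c₀-from R cv))))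
    where
    R : Relabelling c
    R = relabelling-star (record { σ = λ x → x ; σ⁻¹ = λ x → x ; σ∘σ⁻¹ = λ _ → refl
                                 ; σ⁻¹∘σ = λ _ → refl ; agrees = λ _ _ → refl }) c₀∼c

module Encoded {n} {V : Set} (dec : Fin n → V) (adjV : V → V → Bool)
  (adjV-sym : ∀ x y → adjV x y ≡ adjV y x) (adjV-irrefl : ∀ x → adjV x x ≡ false) where

  graph : Graph n
  graph = record
    { adj = λ u v → adjV (dec u) (dec v)
    ; sym = λ u v → adjV-sym (dec u) (dec v)
    ; irrefl = λ v → adjV-irrefl (dec v)
    }

  ProperV : ∀ {k} → (V → Fin k) → Set
  ProperV col = ∀ x y → adjV x y ≡ true → col x ≢ col y

  proper : ∀ {k} {col : V → Fin k} → ProperV col → Proper graph k (λ u → col (dec u))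
  proper col-proper u v = col-proper (dec u) (dec v)

  via-labels : ∀ (P : V → V → Set) {u v X Y} → dec u ≡ X → dec v ≡ Y → P X Y → P (dec u) (dec v)
  via-labels P refl refl p = p

  module Walks {k} (col : V → Fin k) (a b : Fin k) where

    reach-start : ∀ {u x} → dec u ≡ x → InAB a b (col x) → Reach graph (λ w → col (dec w)) a b u u
    reach-start refl x∈ab = here x∈ab

    reach-step : ∀ {v u x y} w → dec u ≡ x → dec w ≡ y →
      Reach graph (λ w → col (dec w)) a b v u → adjV x y ≡ true → InAB a b (col y) →
      Reach graph (λ w → col (dec w)) a b v w
    reach-step w refl refl v⇝u e y∈ab = step v⇝u e y∈ab

  sameSideAdjV : (V → Bool) → V → V → ℕ
  sameSideAdjV sideV x y = if adjV x y ∧ does (sideV x ≟ᵇ sideV y) then 1 else 0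

  sameSideEdges-encoded : ∀ (sideV : V → Bool) ℓ →
    sumFin (λ u → sumFin (λ v → sameSideAdjV sideV (dec u) (dec v))) ≡ ℓ + ℓ →
    sameSideEdges graph (λ u → sideV (dec u)) ≡ ℓ
  sameSideEdges-encoded sideV ℓ total≡ℓ+ℓ = m+m≡n+n⇒m≡n _ ℓ
    (trans (sameSideEdges-handshake graph (λ u → sideV (dec u))) total≡ℓ+ℓ)

module Construction₁ (m N : ℕ) where

  K : ℕ
  K = 4 + m

  -- s a a is kept (adjacent only to t-vertices) so that the s-vertices are indexed by Fin (K * K).
  data V : Set where
    s : Fin K → Fin K → V
    t : Fin K → V
    pad : V

  n : ℕ
  n = K * K + (K + N)

  decS : Fin (K * K) → V
  decS i = s (proj₁ (remQuot {K} K i)) (proj₂ (remQuot {K} K i))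

  decT : Fin (K + N) → V
  decT j = [ t , (λ _ → pad) ] (splitAt K j)

  dec : Fin n → V
  dec u = [ decS , decT ] (splitAt (K * K) u)

  encS : Fin K → Fin K → Fin n
  encS a b = combine a b ↑ˡ (K + N)

  encT : Fin K → Fin n
  encT c = (K * K) ↑ʳ (c ↑ˡ N)

  dec-encS : ∀ a b → dec (encS a b) ≡ s a b
  dec-encS a b =
    trans (cong [ decS , decT ] (splitAt-↑ˡ (K * K) (combine {K} {K} a b) (K + N)))
          (cong (λ p → s (proj₁ p) (proj₂ p)) (remQuot-combine {K} {K} a b))

  dec-encT : ∀ c → dec (encT c) ≡ t c
  dec-encT c = trans (cong [ decS , decT ] (splitAt-↑ʳ (K * K) (K + N) (c ↑ˡ N)))
                     (cong [ t , (λ _ → pad) ] (splitAt-↑ˡ K c N))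

  sumV : ∀ (F : V → ℕ) → sumFin (λ u → F (dec u)) ≡
    sumFin (λ a → sumFin (λ b → F (s a b)))
      + (sumFin (λ c → F (t c)) + sumFin {N} (λ _ → F pad))
  sumV F = trans (sumFin-↑ (K * K) (λ u → F (dec u))) (cong₂ _+_ sum-s sum-rest)
    where
    sum-s : sumFin (λ i → F (dec (i ↑ˡ (K + N)))) ≡ sumFin (λ a → sumFin (λ b → F (s a b)))
    sum-s = trans (sumFin-combine K K (λ i → F (dec (i ↑ˡ (K + N)))))
                  (sumFin-cong (λ a → sumFin-cong (λ b → cong F (dec-encS a b))))
    sum-rest : sumFin (λ j → F (dec ((K * K) ↑ʳ j)))
             ≡ sumFin (λ c → F (t c)) + sumFin {N} (λ _ → F pad)
    sum-rest =
      trans (sumFin-cong (λ j → cong F (cong [ decS , decT ] (splitAt-↑ʳ (K * K) (K + N) j))))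
        (trans (sumFin-↑ K (λ j → F (decT j)))
          (cong₂ _+_ (sumFin-cong (λ c → cong F (cong [ t , (λ _ → pad) ] (splitAt-↑ˡ K c N))))
                     (sumFin-cong (λ p → cong F (cong [ t , (λ _ → pad) ] (splitAt-↑ʳ K N p))))))

  Opposite : Fin K → Fin K → Fin K → Fin K → Set
  Opposite a b a′ b′ = a′ ≡ b × b′ ≡ a × a ≢ b

  opposite : Fin K → Fin K → Fin K → Fin K → Bool
  opposite a b a′ b′ = if does (a′ Fin.≟ b)
    then (if does (b′ Fin.≟ a) then not (does (a Fin.≟ b)) else false)
    else false

  opposite⇒ : ∀ {a b a′ b′} → opposite a b a′ b′ ≡ true → Opposite a b a′ b′
  opposite⇒ {a} {b} {a′} {b′} with a′ Fin.≟ b | b′ Fin.≟ a | a Fin.≟ b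
  ... | yes a′≡b | yes b′≡a | no a≢b = λ _ → a′≡b , b′≡a , a≢b
  ... | yes _ | yes _ | yes _ = λ ()
  ... | yes _ | no _ | _ = λ ()
  ... | no _ | _ | _ = λ ()

  opposite⇐ : ∀ {a b a′ b′} → Opposite a b a′ b′ → opposite a b a′ b′ ≡ true
  opposite⇐ {a} {b} {a′} {b′} (a′≡b , b′≡a , a≢b) with a′ Fin.≟ b | b′ Fin.≟ a | a Fin.≟ b
  ... | yes _ | yes _ | no _ = refl
  ... | yes _ | yes _ | yes a≡b = ⊥-elim (a≢b a≡b)
  ... | yes _ | no b′≢a | _ = ⊥-elim (b′≢a b′≡a)
  ... | no a′≢b | _ | _ = ⊥-elim (a′≢b a′≡b)

  Opposite-sym : ∀ {a b a′ b′} → Opposite a b a′ b′ → Opposite a′ b′ a b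
  Opposite-sym (refl , refl , a≢b) = refl , refl , λ b≡a → a≢b (≡.sym b≡a)

  adjV : V → V → Bool
  adjV (s a b) (s a′ b′) = opposite a b a′ b′
  adjV (s a _) (t c) = not (does (a Fin.≟ c))
  adjV (t c) (s a _) = not (does (a Fin.≟ c))
  adjV _ _ = false

  adjV-sym : ∀ x y → adjV x y ≡ adjV y x
  adjV-sym (s a b) (s a′ b′) =
    Bool-ext (λ e → opposite⇐ (Opposite-sym (opposite⇒ {a} {b} e)))
             (λ e → opposite⇐ (Opposite-sym (opposite⇒ {a′} {b′} e)))
  adjV-sym (s _ _) (t _) = refl
  adjV-sym (s _ _) pad = refl
  adjV-sym (t _) (s _ _) = refl
  adjV-sym (t _) (t _) = refl
  adjV-sym (t _) pad = refl
  adjV-sym pad (s _ _) = refl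
  adjV-sym pad (t _) = refl
  adjV-sym pad pad = refl

  adjV-irrefl : ∀ x → adjV x x ≡ false
  adjV-irrefl (s a b) with opposite a b a b in e
  ... | false = refl
  ... | true with opposite⇒ {a} {b} {a} {b} e
  ...   | a≡b , _ , a≢b = ⊥-elim (a≢b a≡b)
  adjV-irrefl (t _) = refl
  adjV-irrefl pad = refl

  open Encoded dec adjV adjV-sym adjV-irrefl public

  sideV : V → Bool
  sideV (s _ _) = true
  sideV (t _) = false
  sideV pad = true

  q : V → V → ℕ
  q = sameSideAdjV sideV

  [_≢_] : Fin K → Fin K → ℕ
  [ a ≢ b ] = if does (a Fin.≟ b) then 0 else 1

  q-ss : ∀ a b a′ b′ → q (s a b) (s a′ b′) ≡
    (if does (a′ Fin.≟ b) then (if does (b′ Fin.≟ a) then [ a ≢ b ] else 0) else 0)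
  q-ss a b a′ b′ rewrite ∧-identityʳ (opposite a b a′ b′)
    with does (a′ Fin.≟ b) | does (b′ Fin.≟ a) | does (a Fin.≟ b)
  ... | true | true | true = refl
  ... | true | true | false = refl
  ... | true | false | _ = refl
  ... | false | _ | _ = refl

  cross-edge : ∀ x → (if x ∧ false then 1 else 0) ≡ 0
  cross-edge x = cong (λ z → if z then 1 else 0) (∧-zeroʳ x)

  degree-s : ∀ a b → sumFin (λ v → q (s a b) (dec v)) ≡ [ a ≢ b ]
  degree-s a b = begin
    sumFin (λ v → q (s a b) (dec v))
      ≡⟨ sumV (q (s a b)) ⟩
    sumFin (λ a′ → sumFin (λ b′ → q (s a b) (s a′ b′)))
      + (sumFin (λ c → q (s a b) (t c)) + sumFin {N} (λ _ → 0))
      ≡⟨ cong₂ _+_ opposite-count (cong₂ _+_ no-cross-edges (sumFin-zero {N} (λ _ → refl))) ⟩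
    [ a ≢ b ] + 0
      ≡⟨ +-identityʳ _ ⟩
    [ a ≢ b ] ∎
    where
    open ≡.≡-Reasoning
    at-a : Fin K → ℕ
    at-a b′ = if does (b′ Fin.≟ a) then [ a ≢ b ] else 0
    no-cross-edges : sumFin (λ c → q (s a b) (t c)) ≡ 0
    no-cross-edges = sumFin-zero {K} (λ c → cross-edge (not (does (a Fin.≟ c))))
    opposite-count : sumFin (λ a′ → sumFin (λ b′ → q (s a b) (s a′ b′))) ≡ [ a ≢ b ]
    opposite-count = begin
      sumFin (λ a′ → sumFin (λ b′ → q (s a b) (s a′ b′)))
        ≡⟨ sumFin-cong (λ a′ → sumFin-cong (q-ss a b a′)) ⟩
      sumFin (λ a′ → sumFin (λ b′ → if does (a′ Fin.≟ b) then at-a b′ else 0))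
        ≡⟨ sumFin-cong (λ a′ → sumFin-if (does (a′ Fin.≟ b)) at-a) ⟩
      sumFin (λ a′ → if does (a′ Fin.≟ b) then sumFin at-a else 0)
        ≡⟨ sumFin-cong (λ a′ → cong (λ z → if does (a′ Fin.≟ b) then z else 0)
                                    (sumFin-point a (λ _ → [ a ≢ b ]))) ⟩
      sumFin (λ a′ → if does (a′ Fin.≟ b) then [ a ≢ b ] else 0)
        ≡⟨ sumFin-point b (λ _ → [ a ≢ b ]) ⟩
      [ a ≢ b ] ∎

  degree-t : ∀ c → sumFin (λ v → q (t c) (dec v)) ≡ 0
  degree-t c = trans (sumV (q (t c)))
    (cong₂ _+_ (sumFin-zero {K} (λ a → sumFin-zero {K} (λ _ → cross-edge (not (does (a Fin.≟ c))))))
               (cong₂ _+_ (sumFin-zero {K} (λ _ → refl)) (sumFin-zero {N} (λ _ → refl))))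

  degree-pad : sumFin (λ v → q pad (dec v)) ≡ 0
  degree-pad = sumFin-zero {n} (λ _ → refl)

  sameSide-total : sumFin (λ u → sumFin (λ v → q (dec u) (dec v))) ≡ K C 2 + K C 2
  sameSide-total = begin
    sumFin (λ u → sumFin (λ v → q (dec u) (dec v)))
      ≡⟨ sumV (λ x → sumFin (λ v → q x (dec v))) ⟩
    sumFin (λ a → sumFin (λ b → sumFin (λ v → q (s a b) (dec v))))
      + (sumFin (λ c → sumFin (λ v → q (t c) (dec v)))
         + sumFin {N} (λ _ → sumFin (λ v → q pad (dec v))))
      ≡⟨ cong₂ _+_ (sumFin-cong (λ a → sumFin-cong (degree-s a)))
                   (cong₂ _+_ (sumFin-zero {K} degree-t) (sumFin-zero {N} (λ _ → degree-pad))) ⟩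
    sumFin (λ a → sumFin (λ b → [ a ≢ b ])) + 0
      ≡⟨ +-identityʳ _ ⟩
    sumFin (λ a → sumFin (λ b → [ a ≢ b ]))
      ≡⟨ +-cancelʳ-≡ K _ _ (trans (sumFin²-≢ K) (≡.sym (nC2+nC2+n≡n*n K))) ⟩
    K C 2 + K C 2 ∎
    where open ≡.≡-Reasoning

  bPlusE : IsBPlusE graph (K C 2)
  bPlusE = (λ u → sideV (dec u)) , sameSideEdges-encoded sideV (K C 2) sameSide-total

  colour₁ : V → Fin K
  colour₁ (s a _) = a
  colour₁ (t c) = c
  colour₁ pad = zero

  colour₂ : V → Fin (K ∸ 1)
  colour₂ (s a b) = if does (a Finₚ.<? b) then suc zero else zero
  colour₂ (t _) = suc (suc zero)
  colour₂ pad = zero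

  colour₁-proper : ProperV colour₁
  colour₁-proper (s a b) (s a′ b′) e with opposite⇒ {a} {b} {a′} {b′} e
  ... | refl , refl , a≢b = a≢b
  colour₁-proper (s _ _) (t _) e = not-does⇒≢ e
  colour₁-proper (t _) (s _ _) e = λ c≡a → not-does⇒≢ e (≡.sym c≡a)

  colour₂-proper : ProperV colour₂
  colour₂-proper (s a b) (s a′ b′) e with opposite⇒ {a} {b} {a′} {b′} e
  ... | refl , refl , a≢b with <-cmp a b
  ...   | tri< a<b _ _
    rewrite dec-true (a Finₚ.<? b) a<b | dec-false (b Finₚ.<? a) (<-asym a<b) = λ ()
  ...   | tri> _ _ b<a
    rewrite dec-true (b Finₚ.<? a) b<a | dec-false (a Finₚ.<? b) (<-asym b<a) = λ ()
  ...   | tri≈ _ a≡b _ = ⊥-elim (a≢b a≡b)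
  colour₂-proper (s a b) (t _) _ with does (a Finₚ.<? b)
  ... | true = λ ()
  ... | false = λ ()
  colour₂-proper (t _) (s a b) _ with does (a Finₚ.<? b)
  ... | true = λ ()
  ... | false = λ ()

  c₁ c₂ : Fin n → Fin K
  c₁ u = colour₁ (dec u)
  c₂ u = inject₁ (colour₂ (dec u))

  colourable : Colorable graph (K ∸ 1)
  colourable = (λ u → colour₂ (dec u)) , proper colour₂-proper

  coreV : V → Bool
  coreV pad = false
  coreV _ = true

  isolated : ∀ v w → coreV (dec v) ≡ false → adj graph v w ≡ false
  isolated v w with dec v
  ... | pad = λ _ → refl
  ... | s _ _ = λ ()
  ... | t _ = λ ()

  module _ (a b : Fin K) (a≢b : a ≢ b) where

    open Walks colour₁ a b

    private
      b≢a : b ≢ a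
      b≢a b≡a = a≢b (≡.sym b≡a)

      t-a⇝t-b : ∀ {v u} → dec u ≡ t a → Reach graph c₁ a b v u → Reach graph c₁ a b v (encT b)
      t-a⇝t-b du v⇝u =
        reach-step (encT b) (dec-encS a b) (dec-encT b)
          (reach-step (encS a b) (dec-encS b a) (dec-encS a b)
            (reach-step (encS b a) du (dec-encS b a) v⇝u (≢⇒not-does b≢a) (inj₂ refl))
            (opposite⇐ (refl , refl , b≢a)) (inj₁ refl))
          (≢⇒not-does a≢b) (inj₂ refl)

    reach-t : ∀ u → coreV (dec u) ≡ true → InAB a b (c₁ u) → Reach graph c₁ a b u (encT b)
    reach-t u _ u∈ab with dec u in du
    reach-t u _ (inj₁ refl) | s _ _ =
      reach-step (encT b) du (dec-encT b) (reach-start du (inj₁ refl)) (≢⇒not-does a≢b) (inj₂ refl)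
    reach-t u _ (inj₂ refl) | s _ _ =
      t-a⇝t-b (dec-encT a)
        (reach-step (encT a) du (dec-encT a) (reach-start du (inj₂ refl))
          (≢⇒not-does b≢a) (inj₁ refl))
    reach-t u _ (inj₁ refl) | t _ = t-a⇝t-b du (reach-start du (inj₁ refl))
    reach-t u _ (inj₂ refl) | t _ =
      reach-step (encT b) (dec-encS a b) (dec-encT b)
        (reach-step (encS a b) du (dec-encS a b) (reach-start du (inj₂ refl))
          (≢⇒not-does a≢b) (inj₁ refl))
        (≢⇒not-does a≢b) (inj₂ refl)
    reach-t u () _ | pad

  kempe-inequivalent : ¬ KempeEquivalent graph c₁ c₂
  kempe-inequivalent =
    not-kempe-equivalent {c₂} {encT zero} {encT (suc zero)}
      (cong coreV (dec-encT zero)) (cong coreV (dec-encT (suc zero)))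
      (via-labels (λ X Y → colour₁ X ≢ colour₁ Y) {encT zero} {encT (suc zero)}
                  (dec-encT zero) (dec-encT (suc zero)) λ ())
      (via-labels (λ X Y → inject₁ (colour₂ X) ≡ inject₁ (colour₂ Y)) {encT zero} {encT (suc zero)}
                  (dec-encT zero) (dec-encT (suc zero)) refl)
    where
    open Frozen graph (λ u → coreV (dec u)) c₁ isolated (λ a b a≢b → encT b , reach-t a b a≢b)

  kc≥2 : KcAtLeast2 graph K
  kc≥2 = c₁ , c₂ , proper colour₁-proper ,
         (λ u v e c₂u≡c₂v → proper colour₂-proper u v e (inject₁-injective c₂u≡c₂v)) ,
         kempe-inequivalent

  N≤n : N ≤ n
  N≤n = ≤-trans (m≤n+m N K) (m≤n+m (K + N) (K * K))

module Construction₂ (m N : ℕ) where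

  K : ℕ
  K = 4 + m

  data V : Set where
    x : Fin K → V
    y : Fin 3 → V
    pad : V

  n : ℕ
  n = K + (3 + N)

  decY : Fin (3 + N) → V
  decY j = [ y , (λ _ → pad) ] (splitAt 3 j)

  dec : Fin n → V
  dec u = [ x , decY ] (splitAt K u)

  encX : Fin K → Fin n
  encX a = a ↑ˡ (3 + N)

  encY : Fin 3 → Fin n
  encY g = K ↑ʳ (g ↑ˡ N)

  dec-encX : ∀ a → dec (encX a) ≡ x a
  dec-encX a = cong [ x , decY ] (splitAt-↑ˡ K a (3 + N))

  dec-encY : ∀ g → dec (encY g) ≡ y g
  dec-encY g = trans (cong [ x , decY ] (splitAt-↑ʳ K (3 + N) (g ↑ˡ N)))
                     (cong [ y , (λ _ → pad) ] (splitAt-↑ˡ 3 g N))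

  sumV : ∀ (F : V → ℕ) → sumFin (λ u → F (dec u)) ≡
    sumFin (λ a → F (x a)) + (sumFin (λ g → F (y g)) + sumFin {N} (λ _ → F pad))
  sumV F = trans (sumFin-↑ K (λ u → F (dec u))) (cong₂ _+_
    (sumFin-cong (λ a → cong F (dec-encX a)))
    (trans (sumFin-cong (λ j → cong F (cong [ x , decY ] (splitAt-↑ʳ K (3 + N) j))))
      (trans (sumFin-↑ 3 (λ j → F (decY j)))
        (cong₂ _+_ (sumFin-cong (λ g → cong F (cong [ y , (λ _ → pad) ] (splitAt-↑ˡ 3 g N))))
                   (sumFin-cong (λ p → cong F (cong [ y , (λ _ → pad) ] (splitAt-↑ʳ 3 N p))))))))

  emb : Fin 3 → Fin K
  emb g = g ↑ˡ suc m

  rot : Fin 3 → Fin 3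
  rot zero = suc zero
  rot (suc zero) = suc (suc zero)
  rot (suc (suc zero)) = zero

  rot³ : ∀ g → rot (rot (rot g)) ≡ g
  rot³ zero = refl
  rot³ (suc zero) = refl
  rot³ (suc (suc zero)) = refl

  rot-injective : ∀ {g h} → rot g ≡ rot h → g ≡ h
  rot-injective {g} {h} e =
    trans (≡.sym (rot³ g)) (trans (cong (λ z → rot (rot z)) e) (rot³ h))

  rot-≢ : ∀ g → rot g ≢ g
  rot-≢ zero ()
  rot-≢ (suc zero) ()
  rot-≢ (suc (suc zero)) ()

  rot²-≢ : ∀ g → rot (rot g) ≢ g
  rot²-≢ zero ()
  rot²-≢ (suc zero) ()
  rot²-≢ (suc (suc zero)) ()

  emb-injective : ∀ {g h} → emb g ≡ emb h → g ≡ h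
  emb-injective {g} {h} = ↑ˡ-injective (suc m) g h

  avoids : Fin K → Fin 3 → Bool
  avoids a g = not (does (a Fin.≟ emb g)) ∧ not (does (a Fin.≟ emb (rot g)))

  avoids⇒ : ∀ {a g} → avoids a g ≡ true → a ≢ emb g × a ≢ emb (rot g)
  avoids⇒ {a} {g} with a Fin.≟ emb g | a Fin.≟ emb (rot g)
  ... | no a≢g | no a≢rg = λ _ → a≢g , a≢rg
  ... | no _ | yes _ = λ ()
  ... | yes _ | _ = λ ()

  avoids⇐ : ∀ {a g} → a ≢ emb g → a ≢ emb (rot g) → avoids a g ≡ true
  avoids⇐ {a} {g} a≢g a≢rg
    rewrite dec-false (a Fin.≟ emb g) a≢g | dec-false (a Fin.≟ emb (rot g)) a≢rg = refl

  avoids-or-next : ∀ a g → a ≢ emb g → avoids a g ≡ true ⊎ a ≡ emb (rot g)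
  avoids-or-next a g a≢g = by-cases (a Fin.≟ emb (rot g))
    where
    by-cases : Dec (a ≡ emb (rot g)) → avoids a g ≡ true ⊎ a ≡ emb (rot g)
    by-cases (yes a≡rg) = inj₂ a≡rg
    by-cases (no a≢rg) = inj₁ (avoids⇐ a≢g a≢rg)

  adjV : V → V → Bool
  adjV (x a) (x b) = not (does (a Fin.≟ b))
  adjV (y g) (y h) = not (does (g Fin.≟ h))
  adjV (x a) (y g) = avoids a g
  adjV (y g) (x a) = avoids a g
  adjV _ _ = false

  adjV-sym : ∀ u v → adjV u v ≡ adjV v u
  adjV-sym (x a) (x b) = cong not (does-≟-sym Fin._≟_ a b)
  adjV-sym (y g) (y h) = cong not (does-≟-sym Fin._≟_ g h)
  adjV-sym (x _) (y _) = refl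
  adjV-sym (y _) (x _) = refl
  adjV-sym (x _) pad = refl
  adjV-sym (y _) pad = refl
  adjV-sym pad (x _) = refl
  adjV-sym pad (y _) = refl
  adjV-sym pad pad = refl

  adjV-irrefl : ∀ v → adjV v v ≡ false
  adjV-irrefl (x a) = cong not (dec-true (a Fin.≟ a) refl)
  adjV-irrefl (y g) = cong not (dec-true (g Fin.≟ g) refl)
  adjV-irrefl pad = refl

  open Encoded dec adjV adjV-sym adjV-irrefl public

  -- The same-side edges are those of the cliques on {x₀, x₁, x₄, …} and {x₂, x₃}, y₀y₁, x₀y₁,
  -- x₃y₂ and the 2(k − 4) edges from x₄, … to y₀, y₁: binom(k,2) − 1 in all.
  sideV : V → Bool
  sideV (x (suc (suc zero))) = true
  sideV (x (suc (suc (suc zero)))) = true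
  sideV (y (suc (suc zero))) = true
  sideV pad = true
  sideV _ = false

  q : V → V → ℕ
  q = sameSideAdjV sideV

  x⁺ : Fin m → Fin K
  x⁺ r = suc (suc (suc (suc r)))

  q-pad : ∀ w → q w pad ≡ 0
  q-pad (x _) = refl
  q-pad (y _) = refl
  q-pad pad = refl

  degree : ∀ w {d} → sumFin (λ r → q w (x (x⁺ r))) ≡ d → sumFin (λ v → q w (dec v)) ≡
      (q w (x zero) + (q w (x (suc zero)) + (q w (x (suc (suc zero)))
        + (q w (x (suc (suc (suc zero)))) + d))))
    + ((q w (y zero) + (q w (y (suc zero)) + (q w (y (suc (suc zero))) + 0))) + 0)
  degree w refl =
    trans (sumV (q w)) (cong (sumFin (λ a → q w (x a)) +_)
                       (cong (sumFin (λ g → q w (y g)) +_) (sumFin-zero {N} (λ _ → q-pad w))))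

  offDiagonal : Fin m → ℕ
  offDiagonal r = sumFin (λ r′ → if does (r Fin.≟ r′) then 0 else 1)

  all-m : sumFin {m} (λ _ → 1) ≡ m
  all-m = trans (sumFin-const {m} 1) (*-identityʳ m)

  none : ∀ {k} → sumFin {k} (λ _ → 0) ≡ 0
  none {k} = sumFin-zero {k} (λ _ → refl)

  same-side-among-x⁺ : ∀ r → sumFin (λ r′ → q (x (x⁺ r)) (x (x⁺ r′))) ≡ offDiagonal r
  same-side-among-x⁺ r = sumFin-cong (λ r′ → by-cases (does (r Fin.≟ r′)))
    where
    by-cases : ∀ b → (if not b ∧ true then 1 else 0) ≡ (if b then 0 else 1)
    by-cases true = refl
    by-cases false = refl

  degree-x₀ : sumFin (λ v → q (x zero) (dec v)) ≡ m + 2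
  degree-x₀ = trans (degree (x zero) all-m) (≡.sym (+-suc m 1))
  degree-x₁ : sumFin (λ v → q (x (suc zero)) (dec v)) ≡ m + 1
  degree-x₁ = trans (degree (x (suc zero)) all-m) (≡.sym (+-suc m 0))
  degree-x₂ : sumFin (λ v → q (x (suc (suc zero))) (dec v)) ≡ 1
  degree-x₂ = degree (x (suc (suc zero))) (none {m})
  degree-x₃ : sumFin (λ v → q (x (suc (suc (suc zero)))) (dec v)) ≡ 2
  degree-x₃ = degree (x (suc (suc (suc zero)))) (none {m})
  degree-x⁺ : ∀ r → sumFin (λ v → q (x (x⁺ r)) (dec v)) ≡ offDiagonal r + 4
  degree-x⁺ r = trans (degree (x (x⁺ r)) (same-side-among-x⁺ r))
                      (trans (+-comm (suc (suc (offDiagonal r))) 2) (+-comm 4 (offDiagonal r)))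
  degree-y₀ : sumFin (λ v → q (y zero) (dec v)) ≡ m + 1
  degree-y₀ = degree (y zero) all-m
  degree-y₁ : sumFin (λ v → q (y (suc zero)) (dec v)) ≡ m + 2
  degree-y₁ = trans (degree (y (suc zero)) all-m) (≡.sym (+-suc m 1))
  degree-y₂ : sumFin (λ v → q (y (suc (suc zero))) (dec v)) ≡ 1
  degree-y₂ = degree (y (suc (suc zero))) (none {m})
  degree-pad : sumFin (λ v → q pad (dec v)) ≡ 0
  degree-pad = none {n}

  sameSide-total : sumFin (λ u → sumFin (λ v → q (dec u) (dec v))) ≡ (K C 2 ∸ 1) + (K C 2 ∸ 1)
  sameSide-total = m+2≡n+n⇒m≡[n∸1]+[n∸1] _ (K C 2) (+-cancelʳ-≡ K _ _ (begin
    sumFin (λ u → sumFin (λ v → q (dec u) (dec v))) + 2 + K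
      ≡⟨ cong (λ d → d + 2 + K) sum-of-degrees ⟩
    degrees + 2 + K
      ≡⟨ regroup m Z ⟩
    (Z + m) + (8 * m + 16)
      ≡⟨ cong (_+ (8 * m + 16)) (sumFin²-≢ m) ⟩
    m * m + (8 * m + 16)
      ≡⟨ square m ⟩
    K * K
      ≡⟨ ≡.sym (nC2+nC2+n≡n*n K) ⟩
    K C 2 + K C 2 + K ∎))
    where
    open ≡.≡-Reasoning
    open +-*-Solver
    Z : ℕ
    Z = sumFin offDiagonal
    degrees : ℕ
    degrees = ((m + 2) + ((m + 1) + (1 + (2 + (Z + m * 4)))))
            + (((m + 1) + ((m + 2) + (1 + 0))) + 0)
    x⁺-part : sumFin (λ r → sumFin (λ v → q (x (x⁺ r)) (dec v))) ≡ Z + m * 4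
    x⁺-part = trans (sumFin-cong degree-x⁺)
                    (trans (sumFin-+ offDiagonal (λ _ → 4)) (cong (Z +_) (sumFin-const {m} 4)))
    sum-of-degrees : sumFin (λ u → sumFin (λ v → q (dec u) (dec v))) ≡ degrees
    sum-of-degrees = trans (sumV (λ w → sumFin (λ v → q w (dec v)))) (cong₂ _+_
      (cong₂ _+_ degree-x₀ (cong₂ _+_ degree-x₁
        (cong₂ _+_ degree-x₂ (cong₂ _+_ degree-x₃ x⁺-part))))
      (cong₂ _+_ (cong₂ _+_ degree-y₀ (cong₂ _+_ degree-y₁ (cong₂ _+_ degree-y₂ refl)))
                 (sumFin-zero {N} (λ _ → degree-pad))))
    regroup : ∀ m Z →
      ((m + 2) + ((m + 1) + (1 + (2 + (Z + m * 4))))) + (((m + 1) + ((m + 2) + (1 + 0))) + 0)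
        + 2 + (4 + m)
      ≡ (Z + m) + (8 * m + 16)
    regroup = solve 2 (λ m Z →
      ((m :+ con 2) :+ ((m :+ con 1) :+ (con 1 :+ (con 2 :+ (Z :+ m :* con 4)))))
        :+ (((m :+ con 1) :+ ((m :+ con 2) :+ (con 1 :+ con 0))) :+ con 0) :+ con 2 :+ (con 4 :+ m)
      := (Z :+ m) :+ (con 8 :* m :+ con 16)) refl
    square : ∀ m → m * m + (8 * m + 16) ≡ (4 + m) * (4 + m)
    square = solve 1 (λ m → m :* m :+ (con 8 :* m :+ con 16) := (con 4 :+ m) :* (con 4 :+ m)) refl

  bPlusE : IsBPlusE graph (K C 2 ∸ 1)
  bPlusE = (λ u → sideV (dec u)) , sameSideEdges-encoded sideV (K C 2 ∸ 1) sameSide-total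

  colour₁ colour₂ : V → Fin K
  colour₁ (x a) = a
  colour₁ (y g) = emb g
  colour₁ pad = zero
  colour₂ (x a) = a
  colour₂ (y g) = emb (rot g)
  colour₂ pad = zero

  colour₁-proper : ProperV colour₁
  colour₁-proper (x _) (x _) e = not-does⇒≢ e
  colour₁-proper (y _) (y _) e = λ eq → not-does⇒≢ e (emb-injective eq)
  colour₁-proper (x _) (y _) e = proj₁ (avoids⇒ e)
  colour₁-proper (y _) (x _) e = λ eq → proj₁ (avoids⇒ e) (≡.sym eq)

  colour₂-proper : ProperV colour₂
  colour₂-proper (x _) (x _) e = not-does⇒≢ e
  colour₂-proper (y _) (y _) e = λ eq → not-does⇒≢ e (rot-injective (emb-injective eq))
  colour₂-proper (x _) (y _) e = proj₂ (avoids⇒ e)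
  colour₂-proper (y _) (x _) e = λ eq → proj₂ (avoids⇒ e) (≡.sym eq)

  c₁ c₂ : Fin n → Fin K
  c₁ u = colour₁ (dec u)
  c₂ u = colour₂ (dec u)

  x-clique : ∀ {a b} → a ≢ b → adj graph (encX a) (encX b) ≡ true
  x-clique {a} {b} a≢b =
    via-labels (λ X Y → adjV X Y ≡ true) {encX a} {encX b} (dec-encX a) (dec-encX b) (≢⇒not-does a≢b)

  chromatic : ChromaticNumberIs graph K
  chromatic = (c₁ , proper colour₁-proper) , clique-bound
    where
    clique-bound : ∀ j → j < K → ¬ Colorable graph j
    clique-bound j j<K (c , c-proper) with pigeonhole j<K (λ a → c (encX a))
    ... | a , b , a<b , ca≡cb = c-proper (encX a) (encX b) (x-clique (<⇒≢ a<b)) ca≡cb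

  coreV : V → Bool
  coreV pad = false
  coreV _ = true

  isolated : ∀ v w → coreV (dec v) ≡ false → adj graph v w ≡ false
  isolated v w with dec v
  ... | pad = λ _ → refl
  ... | x _ = λ ()
  ... | y _ = λ ()

  module _ (a b : Fin K) (a≢b : a ≢ b) where

    open Walks colour₁ a b

    private
      ReachesPair : Fin n → Set
      ReachesPair u = Σ (Fin K) λ c → InAB a b c × Reach graph c₁ a b u (encX c)

      other : ∀ {c} → InAB a b c → Σ (Fin K) λ o → InAB a b o × c ≢ o
      other (inj₁ refl) = b , inj₂ refl , a≢b
      other (inj₂ refl) = a , inj₁ refl , λ b≡a → a≢b (≡.sym b≡a)

      y⇝pair : ∀ u g → dec u ≡ y g → InAB a b (emb g) → ReachesPair u
      y⇝pair u g du g∈ab with other g∈ab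
      ... | o , o∈ab , g≢o with avoids-or-next o g (λ o≡g → g≢o (≡.sym o≡g))
      ...   | inj₁ o~g = o , o∈ab ,
        reach-step (encX o) du (dec-encX o) (reach-start du g∈ab) o~g o∈ab
      ...   | inj₂ refl = emb g , g∈ab ,
        reach-step (encX (emb g)) (dec-encY (rot g)) (dec-encX (emb g))
          (reach-step (encY (rot g)) du (dec-encY (rot g)) (reach-start du g∈ab)
            (≢⇒not-does (λ g≡rg → rot-≢ g (≡.sym g≡rg))) o∈ab)
          (avoids⇐ (λ e → rot-≢ g (≡.sym (emb-injective e)))
                   (λ e → rot²-≢ g (≡.sym (emb-injective e))))
          g∈ab

      core⇝pair : ∀ u → coreV (dec u) ≡ true → InAB a b (c₁ u) → ReachesPair u
      core⇝pair u _ u∈ab with dec u in du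
      ... | x c with other u∈ab
      ...   | o , o∈ab , c≢o = o , o∈ab ,
        reach-step (encX o) du (dec-encX o) (reach-start du u∈ab) (≢⇒not-does c≢o) o∈ab
      core⇝pair u _ u∈ab | y g = y⇝pair u g du u∈ab
      core⇝pair u () _ | pad

    reach-x : ∀ u → coreV (dec u) ≡ true → InAB a b (c₁ u) → Reach graph c₁ a b u (encX b)
    reach-x u cu u∈ab with core⇝pair u cu u∈ab
    ... | _ , inj₂ refl , u⇝b = u⇝b
    ... | _ , inj₁ refl , u⇝a =
      reach-step (encX b) (dec-encX a) (dec-encX b) u⇝a (≢⇒not-does a≢b) (inj₂ refl)

  kempe-inequivalent : ¬ KempeEquivalent graph c₁ c₂
  kempe-inequivalent =
    not-kempe-equivalent {c₂} {encY zero} {encX (suc zero)}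
      (cong coreV (dec-encY zero)) (cong coreV (dec-encX (suc zero)))
      (via-labels (λ X Y → colour₁ X ≢ colour₁ Y) {encY zero} {encX (suc zero)}
                  (dec-encY zero) (dec-encX (suc zero)) λ ())
      (via-labels (λ X Y → colour₂ X ≡ colour₂ Y) {encY zero} {encX (suc zero)}
                  (dec-encY zero) (dec-encX (suc zero)) refl)
    where
    open Frozen graph (λ u → coreV (dec u)) c₁ isolated (λ a b a≢b → encX b , reach-x a b a≢b)

  kc≥2 : KcAtLeast2 graph K
  kc≥2 = c₁ , c₂ , proper colour₁-proper , proper colour₂-proper , kempe-inequivalent

  N≤n : N ≤ n
  N≤n = ≤-trans (m≤n+m N 3) (m≤n+m (3 + N) K)

proposition4 : (k : ℕ) → 4 ≤ k →
    ((N : ℕ) → Σ ℕ λ n → N ≤ n × Σ (Graph n) λ G →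
        Colorable G (k ∸ 1) × IsBPlusE G (k C 2) × KcAtLeast2 G k)
    × ((N : ℕ) → Σ ℕ λ n → N ≤ n × Σ (Graph n) λ G →
        ChromaticNumberIs G k × IsBPlusE G ((k C 2) ∸ 1) × KcAtLeast2 G k)
proposition4 (suc (suc (suc (suc m)))) (s≤s (s≤s (s≤s (s≤s z≤n)))) =
    (λ N → let open Construction₁ m N in n , N≤n , graph , colourable , bPlusE , kc≥2)
  , (λ N → let open Construction₂ m N in n , N≤n , graph , chromatic , bPlusE , kc≥2)
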